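{- Let $r,s\ge1$ and $p_1,\dots,p_r,q_1,\dots,q_s$ be positive integers with $\{p_i\}\cap\{q_j\}=\emptyset$, $q_s=1$ and $\sum_ip_i=\sum_jq_j$; put $n=r+s-1$, $S=\{0,\dots,n\}$, $S_+=\{0,\dots,r-1\}$, $S_-=\{r,\dots,n\}$, and let ${\bf e}_i$, $g(x)$, $g(x;T)$ be as in the context. Then $$g(x)=\sum_{k=0}^{r-1}(-1)^{r-1-k}\sum_{T\subset S_+,\,|T|=k}g(x;T\cup S_-)=\sum_{k=0}^{s-1}(-1)^{s-1-k}\sum_{T\subset S_-,\,|T|=k}g(x;S_+\cup T).$$
   Context: ${\bf e}_0=[1,0,\dots,0]\in\mathbb Z^n$; for $1\le i\le n-1$, ${\bf e}_i$ has first coordinate $1$, $(i+1)$-st coordinate $1$, other coordinates $0$; ${\bf e}_n=[1,p_1,\dots,p_{r-1},-q_1,\dots,-q_{s-1}]$. For nonempty $T\subseteq S$, $C(\Delta_T)=\{\sum_{j\in T}a_j{\bf e}_j:a_j\ge0\}$, and $C(\Delta)=C(\Delta_S)$. The weight of a point of these cones is its first coordinate. $m(k;T)$ (resp. $m(k)$) is the number of lattice points of weight $k$ in $C(\Delta_T)$ (resp. $C(\Delta)$), and $g(x;T)=\sum_{k\ge0}m(k;T)x^k$, $g(x)=\sum_{k\ge0}m(k)x^k$ as formal power series. -}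

module Defs where

open import Data.Bool using (Bool; true; false; if_then_else_)
open import Data.Nat using (ℕ; zero; suc; _≡ᵇ_; _∸_; _+_)
import Data.Nat as N
open import Data.Nat.Properties using (+-suc)
open import Data.Integer as ℤ using (ℤ; +_; -_)
import Data.Integer as Z
open import Data.Rational as ℚ using (ℚ; 0ℚ)
open import Data.Fin using (Fin; toℕ)
open import Data.Fin.Subset using (Subset; _∈_; _∉_; ∣_∣; ⊤)
open import Data.Vec as V using (Vec; []; _∷_; _++_; tabulate; lookup; init; cast)
open import Data.List as L using (List; length)
open import Data.List.Membership.Propositional as LM using ()
open import Data.List.Relation.Unary.Unique.Propositional using (Unique)
open import Data.Product using (Σ; ∃; _×_)
open import Function.Bundles using (_⇔_)
open import Relation.Binary.PropositionalEquality using (_≡_; sym)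

Σℚ : ∀ {m} → (Fin m → ℚ) → ℚ
Σℚ {zero}  f = 0ℚ
Σℚ {suc m} f = f Fin.zero ℚ.+ Σℚ (λ i → f (Fin.suc i))
  where import Data.Fin as Fin

sumℤ : List ℤ → ℤ
sumℤ = L.foldr Z._+_ (+ 0)

allSubsets : ∀ m → List (Subset m)
allSubsets zero    = [] L.∷ L.[]
allSubsets (suc m) = L.map (true ∷_) (allSubsets m) L.++ L.map (false ∷_) (allSubsets m)

toℚ : ℤ → ℚ
toℚ z = z ℚ./ 1

-- Setting: r = suc r', s = suc s', n = r + s - 1 = r' + suc s',
-- p = [p_1..p_r], q = [q_1..q_s].  S = {0..n} = Fin (r + s) = Fin (suc n).
module Setting (r' s' : ℕ) (p : Vec ℕ (suc r')) (q : Vec ℕ (suc s')) where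

  n : ℕ
  n = r' + suc s'

  eₙ : Vec ℤ n
  eₙ = cast (sym (+-suc r' s'))
         ((+ 1 ∷ V.map +_ (init p)) ++ V.map (λ x → - (+ x)) (init q))

  -- coordinate c (0-based) of the generator e_j, j ∈ {0..n}
  genCoord : Fin (suc n) → Fin n → ℤ
  genCoord j c =
    if toℕ j ≡ᵇ n then lookup eₙ c
    else if toℕ c ≡ᵇ 0 then + 1
    else if toℕ c ≡ᵇ toℕ j then + 1
    else + 0

  e : Fin (suc n) → Vec ℤ n
  e j = tabulate (genCoord j)

  InCone : Subset (suc n) → Vec ℤ n → Set
  InCone T v = Σ (Fin (suc n) → ℚ) λ a →
    (∀ j → 0ℚ ℚ.≤ a j) × (∀ j → j ∉ T → a j ≡ 0ℚ) ×
    (∀ c → toℚ (lookup v c) ≡ Σℚ (λ j → a j ℚ.* toℚ (lookup (e j) c)))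

  weight : Vec ℤ n → ℤ
  weight v = V.head (cast (+-suc r' s') v)

  PointOfWeight : ℕ → Subset (suc n) → Vec ℤ n → Set
  PointOfWeight k T v = InCone T v × weight v ≡ + k

  IsCount : ℕ → Subset (suc n) → ℕ → Set
  IsCount k T m = Σ (List (Vec ℤ n)) λ xs →
    Unique xs × (∀ v → (v LM.∈ xs) ⇔ PointOfWeight k T v) × length xs ≡ m

altSubsetSum : ∀ m → (Subset m → ℕ) → ℤ
altSubsetSum m f = sumℤ (L.map (λ k →
    ((- (+ 1)) Z.^ (m ∸ 1 ∸ k)) Z.*
      sumℤ (L.map (λ T → + f T) (L.filter (λ T → ∣ T ∣ N.≟ k) (allSubsets m))))
  (L.upTo m))

-- The n + 1 generators of ℤⁿ satisfy exactly one linear relation, Σⱼ ρⱼ eⱼ = 0 with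
-- ρ = (−p_r, −p₁, …, −p_{r−1}, q₁, …, q_s) (this uses Σ pᵢ = Σ qⱼ and q_s = 1), so two
-- representations of a point differ by a multiple of ρ, and ρ is negative exactly on S₊.
-- Sliding a representation along ρ until a coefficient on S₊ vanishes shows that every point
-- of C(Δ) lies in a facet cone C(Δ_{S∖{i}}) with i ∈ S₊; comparing two such representations
-- shows that it lies in C(Δ_{T ∪ S₋}) exactly when it lies in C(Δ_{S∖{i}}) for all i ∈ S₊ ∖ T.
-- Inclusion–exclusion over the facets containing each point of weight k then gives the first
-- identity; the second is the same argument for the relation −ρ, which is negative on S₋.
module Submission where

open import Defs
open import Data.Nat using (ℕ; suc)
open import Data.Fin using (Fin)
open import Data.Vec using (Vec)
open import Data.Rational using (ℚ)
open import Data.Empty using (⊥-elim)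
open import Data.Product using (Σ; ∃; _×_; _,_; proj₁; proj₂)
open import Function using (_∘_; id)
open import Data.Sum using (_⊎_; inj₁; inj₂)
open import Relation.Binary.PropositionalEquality
  using (_≡_; _≢_; refl; sym; trans; cong; cong₂; subst; module ≡-Reasoning)

module Vectors where

  open import Data.Nat as ℕ using (zero; suc; _+_)
  import Data.Nat.Properties as ℕ
  open import Data.Fin using (zero; suc; inject₁; fromℕ; _↑ˡ_; _↑ʳ_; splitAt)
  open import Data.Fin.Properties using (splitAt⁻¹-↑ˡ; splitAt⁻¹-↑ʳ)
  open import Data.Vec using (Vec; []; _∷_; _∷ʳ_; _++_; lookup; sum; init; last; initLast)
  import Data.Vec.Properties as Vec
  open import Data.Fin.Subset using (Subset; _∈_)

  private variable
    A : Set
    m : ℕ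

  inject₁-or-last : ∀ (j : Fin (suc m)) → (∃ λ c → j ≡ inject₁ c) ⊎ j ≡ fromℕ m
  inject₁-or-last {zero}  zero    = inj₂ refl
  inject₁-or-last {suc m} zero    = inj₁ (zero , refl)
  inject₁-or-last {suc m} (suc j) with inject₁-or-last j
  ... | inj₁ (c , refl) = inj₁ (suc c , refl)
  ... | inj₂ refl       = inj₂ refl

  ↑ˡ-or-↑ʳ : ∀ m {n} (j : Fin (m + n)) → (∃ λ i → j ≡ i ↑ˡ n) ⊎ (∃ λ i → j ≡ m ↑ʳ i)
  ↑ˡ-or-↑ʳ m j with splitAt m j in eq
  ... | inj₁ i = inj₁ (i , sym (splitAt⁻¹-↑ˡ eq))
  ... | inj₂ i = inj₂ (i , sym (splitAt⁻¹-↑ʳ eq))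

  lookup-∷ʳ-inject₁ : ∀ (xs : Vec A m) x i → lookup (xs ∷ʳ x) (inject₁ i) ≡ lookup xs i
  lookup-∷ʳ-inject₁ (y ∷ xs) x zero    = refl
  lookup-∷ʳ-inject₁ (y ∷ xs) x (suc i) = lookup-∷ʳ-inject₁ xs x i

  lookup-∷ʳ-last : ∀ (xs : Vec A m) x → lookup (xs ∷ʳ x) (fromℕ m) ≡ x
  lookup-∷ʳ-last []       x = refl
  lookup-∷ʳ-last (y ∷ xs) x = lookup-∷ʳ-last xs x

  module _ {m n} {T : Subset m} {U : Subset n} where

    ↑ˡ∈-++⁻ : ∀ {i} → (i ↑ˡ n) ∈ (T ++ U) → i ∈ T
    ↑ˡ∈-++⁻ {i} i∈ = Vec.lookup⇒[]= i T (trans (sym (Vec.lookup-++ˡ T U i)) (Vec.[]=⇒lookup i∈))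

    ↑ˡ∈-++⁺ : ∀ {i} → i ∈ T → (i ↑ˡ n) ∈ (T ++ U)
    ↑ˡ∈-++⁺ {i} i∈ = Vec.lookup⇒[]= (i ↑ˡ n) (T ++ U) (trans (Vec.lookup-++ˡ T U i) (Vec.[]=⇒lookup i∈))

    ↑ʳ∈-++⁻ : ∀ {i} → (m ↑ʳ i) ∈ (T ++ U) → i ∈ U
    ↑ʳ∈-++⁻ {i} i∈ = Vec.lookup⇒[]= i U (trans (sym (Vec.lookup-++ʳ T U i)) (Vec.[]=⇒lookup i∈))

    ↑ʳ∈-++⁺ : ∀ {i} → i ∈ U → (m ↑ʳ i) ∈ (T ++ U)
    ↑ʳ∈-++⁺ {i} i∈ = Vec.lookup⇒[]= (m ↑ʳ i) (T ++ U) (trans (Vec.lookup-++ʳ T U i) (Vec.[]=⇒lookup i∈))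

  init∷ʳlast : ∀ (xs : Vec A (suc m)) → xs ≡ init xs ∷ʳ last xs
  init∷ʳlast xs = proj₂ (proj₂ (initLast xs))

  sum-∷ʳ : ∀ (xs : Vec ℕ m) x → sum (xs ∷ʳ x) ≡ sum xs + x
  sum-∷ʳ []       x = ℕ.+-identityʳ x
  sum-∷ʳ (y ∷ xs) x = trans (cong (y +_) (sum-∷ʳ xs x)) (sym (ℕ.+-assoc y (sum xs) x))

module Rational where

  open import Data.Nat as ℕ using (zero; suc)
  import Data.Nat.Coprimality as Coprime
  open import Data.Integer as ℤ using (ℤ; +_; -[1+_])
  import Data.Integer.Properties as ℤ
  open import Data.Fin using (zero)
  open import Data.Rational using (0ℚ; mkℚ; _+_; -_; _≤_; _<_; *<*)
  open import Data.Rational.Properties using (normalize-coprime; ≤-decTotalOrder)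
  open import Data.List using (allFin)
  import Data.List.Relation.Unary.All as All
  open import Data.List.Membership.Propositional.Properties using (∈-allFin)
  open import Relation.Binary.Bundles using (DecTotalOrder)
  open import Data.List.Extrema (DecTotalOrder.totalOrder ≤-decTotalOrder) using (argmin; f[argmin]≤f[xs])

  toℚ≡mkℚ : ∀ z → toℚ z ≡ mkℚ z 0 (Coprime.sym (Coprime.1-coprimeTo ℤ.∣ z ∣))
  toℚ≡mkℚ (+ n)    = normalize-coprime (Coprime.sym (Coprime.1-coprimeTo n))
  toℚ≡mkℚ -[1+ n ] = cong -_ (normalize-coprime (Coprime.sym (Coprime.1-coprimeTo (suc n))))

  toℚ-+ : ∀ a b → toℚ (a ℤ.+ b) ≡ toℚ a + toℚ b
  toℚ-+ a b rewrite toℚ≡mkℚ a | toℚ≡mkℚ b =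
    cong₂ (λ x y → toℚ (x ℤ.+ y)) (sym (ℤ.*-identityʳ a)) (sym (ℤ.*-identityʳ b))

  toℚ-neg : ∀ a → toℚ (ℤ.- a) ≡ - toℚ a
  toℚ-neg a rewrite toℚ≡mkℚ a | toℚ≡mkℚ (ℤ.- a) = mkℚ-neg a
    where
    mkℚ-neg : ∀ a → mkℚ (ℤ.- a) 0 (Coprime.sym (Coprime.1-coprimeTo ℤ.∣ ℤ.- a ∣))
                  ≡ - mkℚ a 0 (Coprime.sym (Coprime.1-coprimeTo ℤ.∣ a ∣))
    mkℚ-neg (+ zero)  = refl
    mkℚ-neg (+ suc n) = refl
    mkℚ-neg -[1+ n ]  = refl

  0<⇒0<toℚ : ∀ {x} → 0 ℕ.< x → 0ℚ < toℚ (+ x)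
  0<⇒0<toℚ {suc x} _ rewrite toℚ≡mkℚ (+ suc x) = *<* (ℤ.+<+ (ℕ.s≤s ℕ.z≤n))

  0<⇒toℚ-neg<0 : ∀ {x} → 0 ℕ.< x → toℚ (ℤ.- + x) < 0ℚ
  0<⇒toℚ-neg<0 {suc x} _ rewrite toℚ≡mkℚ -[1+ x ] = *<* ℤ.-<+

  minimizer : ∀ {M} (f : Fin (suc M) → ℚ) → ∃ λ i → ∀ j → f i ≤ f j
  minimizer {M} f = argmin f zero (allFin (suc M)) ,
    λ j → All.lookup (f[argmin]≤f[xs] {f = f} zero (allFin (suc M))) (∈-allFin j)

module FiniteSums where

  open Rational using (toℚ-+; toℚ-neg)
  open import Data.Nat as ℕ using (zero; suc)
  open import Data.Integer as ℤ using (ℤ; +_)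
  open import Data.Fin using (zero; suc; inject₁; fromℕ; punchIn)
  open import Data.Fin.Properties using (punchInᵢ≢i)
  open import Data.Vec as Vec using ([]; _∷_; lookup; _++_)
  open import Data.Rational using (0ℚ; _+_; _*_; -_)
  open import Data.Rational.Properties using (+-identityˡ; +-identityʳ; +-assoc; neg-distrib-+; +-*-ring)
  open import Algebra.Bundles using (Ring)
  open import Algebra.Properties.Semiring.Sum (Ring.semiring +-*-ring)
    using (sum; sum-cong-≗; ∑-distrib-+; *-distribˡ-sum; sum-init-last; sum-remove)

  Σℚ≡sum : ∀ {m} (f : Fin m → ℚ) → Σℚ f ≡ sum f
  Σℚ≡sum {zero}  f = refl
  Σℚ≡sum {suc m} f = cong (_+_ (f zero)) (Σℚ≡sum (λ i → f (suc i)))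

  Σℚ-cong : ∀ {m} {f g : Fin m → ℚ} → (∀ i → f i ≡ g i) → Σℚ f ≡ Σℚ g
  Σℚ-cong {f = f} {g} f≗g =
    trans (Σℚ≡sum f) (trans (sum-cong-≗ {x = f} {y = g} f≗g) (sym (Σℚ≡sum g)))

  Σℚ-+ : ∀ {m} (f g : Fin m → ℚ) → Σℚ (λ i → f i + g i) ≡ Σℚ f + Σℚ g
  Σℚ-+ f g = trans (Σℚ≡sum (λ i → f i + g i))
    (trans (∑-distrib-+ f g) (sym (cong₂ _+_ (Σℚ≡sum f) (Σℚ≡sum g))))

  Σℚ-*ˡ : ∀ {m} t (f : Fin m → ℚ) → Σℚ (λ i → t * f i) ≡ t * Σℚ f
  Σℚ-*ˡ t f = trans (Σℚ≡sum (λ i → t * f i))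
    (trans (sym (*-distribˡ-sum t f)) (cong (t *_) (sym (Σℚ≡sum f))))

  Σℚ-zero : ∀ {m} (f : Fin m → ℚ) → (∀ i → f i ≡ 0ℚ) → Σℚ f ≡ 0ℚ
  Σℚ-zero {zero}  f f≗0 = refl
  Σℚ-zero {suc m} f f≗0 = cong₂ _+_ (f≗0 zero) (Σℚ-zero (λ i → f (suc i)) (λ i → f≗0 (suc i)))

  Σℚ-init-last : ∀ {m} (f : Fin (suc m) → ℚ) → Σℚ f ≡ Σℚ (λ i → f (inject₁ i)) + f (fromℕ m)
  Σℚ-init-last f = trans (Σℚ≡sum f)
    (trans (sum-init-last f) (cong (_+ f (fromℕ _)) (sym (Σℚ≡sum (λ i → f (inject₁ i))))))

  Σℚ-single : ∀ {m} (f : Fin m → ℚ) i → (∀ j → j ≢ i → f j ≡ 0ℚ) → Σℚ f ≡ f i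
  Σℚ-single {suc m} f i others≡0 = begin
    Σℚ f                              ≡⟨ Σℚ≡sum f ⟩
    sum f                             ≡⟨ sum-remove f ⟩
    f i + sum (λ j → f (punchIn i j)) ≡⟨ cong (_+_ (f i)) (sym (Σℚ≡sum (λ j → f (punchIn i j)))) ⟩
    f i + Σℚ (λ j → f (punchIn i j))  ≡⟨ cong (_+_ (f i)) (Σℚ-zero _ (λ j → others≡0 _ (punchInᵢ≢i i j))) ⟩
    f i + 0ℚ                          ≡⟨ +-identityʳ (f i) ⟩
    f i                               ∎
    where open ≡-Reasoning

  Σℚ-toℚ-++ : ∀ {a b} (xs : Vec ℤ a) (ys : Vec ℤ b) →
    Σℚ (λ i → toℚ (lookup (xs ++ ys) i)) ≡ Σℚ (λ i → toℚ (lookup xs i)) + Σℚ (λ i → toℚ (lookup ys i))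
  Σℚ-toℚ-++ []       ys = sym (+-identityˡ _)
  Σℚ-toℚ-++ (x ∷ xs) ys =
    trans (cong (_+_ (toℚ x)) (Σℚ-toℚ-++ xs ys)) (sym (+-assoc (toℚ x) _ _))

  Σℚ-toℚ-map-+ : ∀ {a} (xs : Vec ℕ a) → Σℚ (λ i → toℚ (lookup (Vec.map +_ xs) i)) ≡ toℚ (+ Vec.sum xs)
  Σℚ-toℚ-map-+ []       = refl
  Σℚ-toℚ-map-+ (x ∷ xs) = trans (cong (_+_ (toℚ (+ x))) (Σℚ-toℚ-map-+ xs)) (sym (toℚ-+ (+ x) (+ Vec.sum xs)))

  Σℚ-toℚ-map-neg : ∀ {a} (xs : Vec ℕ a) →
    Σℚ (λ i → toℚ (lookup (Vec.map (λ x → ℤ.- (+ x)) xs) i)) ≡ - toℚ (+ Vec.sum xs)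
  Σℚ-toℚ-map-neg []       = refl
  Σℚ-toℚ-map-neg (x ∷ xs) = begin
    toℚ (ℤ.- (+ x)) + Σℚ (λ i → toℚ (lookup (Vec.map (λ x → ℤ.- (+ x)) xs) i))
      ≡⟨ cong₂ _+_ (toℚ-neg (+ x)) (Σℚ-toℚ-map-neg xs) ⟩
    - toℚ (+ x) + - toℚ (+ Vec.sum xs)  ≡⟨ neg-distrib-+ (toℚ (+ x)) (toℚ (+ Vec.sum xs)) ⟨
    - (toℚ (+ x) + toℚ (+ Vec.sum xs))  ≡⟨ cong -_ (toℚ-+ (+ x) (+ Vec.sum xs)) ⟨
    - toℚ (+ (x ℕ.+ Vec.sum xs))        ∎
    where open ≡-Reasoning

module ConeWithRelation {N d : ℕ} (E : Fin N → Fin d → ℚ) where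

  open Rational using (minimizer)
  open FiniteSums using (Σℚ-cong; Σℚ-+; Σℚ-*ˡ)
  open import Data.Nat using (suc)
  open import Data.Rational
    using (ℚ; 0ℚ; 1ℚ; _+_; _*_; -_; _≤_; _<_; 1/_; NonZero; negative; nonPositive; nonNegative)
  open import Data.Rational.Properties
  open import Data.Rational.Solver using (module +-*-Solver)
  open +-*-Solver

  combination : (Fin N → ℚ) → Fin d → ℚ
  combination a c = Σℚ (λ j → a j * E j c)

  Represents : (Fin d → ℚ) → (Fin N → ℚ) → Set
  Represents x a = ∀ c → x c ≡ combination a c

  Cone : (Fin N → Set) → (Fin d → ℚ) → Set
  Cone Z x = Σ (Fin N → ℚ) λ a → (∀ j → 0ℚ ≤ a j) × (∀ j → Z j → a j ≡ 0ℚ) × Represents x a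

  Cone-mono : ∀ {Z Z′ x} → (∀ j → Z′ j → Z j) → Cone Z x → Cone Z′ x
  Cone-mono Z′⊆Z (a , a≥0 , a≡0 , rep) = a , a≥0 , (λ j z′ → a≡0 j (Z′⊆Z j z′)) , rep

  combination-+-* : ∀ a b t c →
    combination (λ j → a j + t * b j) c ≡ combination a c + t * combination b c
  combination-+-* a b t c = begin
    Σℚ (λ j → (a j + t * b j) * E j c)
      ≡⟨ Σℚ-cong (λ j → distrib (a j) t (b j) (E j c)) ⟩
    Σℚ (λ j → a j * E j c + t * (b j * E j c))
      ≡⟨ Σℚ-+ (λ j → a j * E j c) (λ j → t * (b j * E j c)) ⟩
    combination a c + Σℚ (λ j → t * (b j * E j c))
      ≡⟨ cong (_+_ (combination a c)) (Σℚ-*ˡ t (λ j → b j * E j c)) ⟩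
    combination a c + t * combination b c ∎
    where
    open ≡-Reasoning
    distrib : ∀ x t y e → (x + t * y) * e ≡ x * e + t * (y * e)
    distrib = solve 4 (λ x t y e → (x :+ t :* y) :* e := x :* e :+ t :* (y :* e)) refl

  combination-neg : ∀ a c → combination (λ j → - a j) c ≡ - combination a c
  combination-neg a c = begin
    Σℚ (λ j → - a j * E j c)
      ≡⟨ Σℚ-cong (λ j → solve 2 (λ x e → :- x :* e := :- con 1ℚ :* (x :* e)) refl (a j) (E j c)) ⟩
    Σℚ (λ j → - 1ℚ * (a j * E j c))
      ≡⟨ Σℚ-*ˡ (- 1ℚ) (λ j → a j * E j c) ⟩
    - 1ℚ * combination a c
      ≡⟨ solve 1 (λ x → :- con 1ℚ :* x := :- x) refl (combination a c) ⟩
    - combination a c ∎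
    where open ≡-Reasoning

  module _ (ρ : Fin N → ℚ) (ρ-kernel : ∀ c → combination ρ c ≡ 0ℚ)
           (kernel⇒multiple : ∀ D → (∀ c → combination D c ≡ 0ℚ) → ∃ λ t → ∀ j → D j ≡ t * ρ j)
           where

    Represents-shift : ∀ {x a} t → Represents x a → Represents x (λ j → a j + t * ρ j)
    Represents-shift {x} {a} t rep c = begin
      x c                                   ≡⟨ rep c ⟩
      combination a c                       ≡⟨ sym (+-identityʳ _) ⟩
      combination a c + 0ℚ                  ≡⟨ cong (_+_ (combination a c)) (sym (*-zeroʳ t)) ⟩
      combination a c + t * 0ℚ              ≡⟨ cong (λ y → combination a c + t * y) (sym (ρ-kernel c)) ⟩
      combination a c + t * combination ρ c ≡⟨ sym (combination-+-* a ρ t c) ⟩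
      combination (λ j → a j + t * ρ j) c   ∎
      where open ≡-Reasoning

    representations-differ-by-relation : ∀ {x a b} → Represents x a → Represents x b →
      ∃ λ t → ∀ j → b j ≡ a j + t * ρ j
    representations-differ-by-relation {x} {a} {b} rep-a rep-b = t , b≡a+tρ
      where
      D : Fin N → ℚ
      D j = b j + (- 1ℚ) * a j
      D-kernel : ∀ c → combination D c ≡ 0ℚ
      D-kernel c = begin
        combination D c
          ≡⟨ combination-+-* b a (- 1ℚ) c ⟩
        combination b c + (- 1ℚ) * combination a c
          ≡⟨ cong₂ (λ y z → y + (- 1ℚ) * z) (sym (rep-b c)) (sym (rep-a c)) ⟩
        x c + (- 1ℚ) * x c
          ≡⟨ solve 1 (λ y → y :+ (:- con 1ℚ) :* y := con 0ℚ) refl (x c) ⟩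
        0ℚ ∎
        where open ≡-Reasoning
      t = proj₁ (kernel⇒multiple D D-kernel)
      b≡a+tρ : ∀ j → b j ≡ a j + t * ρ j
      b≡a+tρ j = trans (solve 2 (λ b a → b := a :+ (b :+ (:- con 1ℚ) :* a)) refl (b j) (a j))
                       (cong (_+_ (a j)) (proj₂ (kernel⇒multiple D D-kernel) j))

    -- b − a = t ρ; at j₀, where a vanishes, b ≥ 0 forces t ≤ 0, and at j, where b vanishes, a = − t ρ ≤ 0.
    zero-propagates : ∀ {x a b j₀ j} → ρ j₀ < 0ℚ → ρ j < 0ℚ →
      (∀ j → 0ℚ ≤ a j) → Represents x a → a j₀ ≡ 0ℚ →
      (∀ j → 0ℚ ≤ b j) → Represents x b → b j ≡ 0ℚ → a j ≡ 0ℚ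
    zero-propagates {a = a} {b} {j₀} {j} ρj₀<0 ρj<0 a≥0 rep-a aj₀≡0 b≥0 rep-b bj≡0 =
      ≤-antisym aj≤0 (a≥0 j)
      where
      diff = representations-differ-by-relation {a = a} {b} rep-a rep-b
      t = proj₁ diff
      t≤0 : t ≤ 0ℚ
      t≤0 = *-cancelʳ-≤-neg (ρ j₀) {{negative ρj₀<0}} (begin
        0ℚ * ρ j₀        ≡⟨ *-zeroˡ (ρ j₀) ⟩
        0ℚ               ≤⟨ b≥0 j₀ ⟩
        b j₀             ≡⟨ proj₂ diff j₀ ⟩
        a j₀ + t * ρ j₀  ≡⟨ cong (_+ t * ρ j₀) aj₀≡0 ⟩
        0ℚ + t * ρ j₀    ≡⟨ +-identityˡ _ ⟩
        t * ρ j₀         ∎)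
        where open ≤-Reasoning
      tρj≥0 : 0ℚ ≤ t * ρ j
      tρj≥0 = subst (_≤ t * ρ j) (*-zeroˡ (ρ j))
        (*-monoʳ-≤-nonPos (ρ j) {{nonPositive (<⇒≤ ρj<0)}} t≤0)
      aj≤0 : a j ≤ 0ℚ
      aj≤0 = begin
        a j                           ≡⟨ solve 2 (λ a y → a := (a :+ y) :+ (:- y)) refl (a j) (t * ρ j) ⟩
        (a j + t * ρ j) + - (t * ρ j) ≡⟨ cong (_+ - (t * ρ j)) (trans (sym (proj₂ diff j)) bj≡0) ⟩
        0ℚ + - (t * ρ j)              ≡⟨ +-identityˡ _ ⟩
        - (t * ρ j)                   ≤⟨ neg-antimono-≤ tρj≥0 ⟩
        - 0ℚ                          ≡⟨⟩
        0ℚ                            ∎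
        where open ≤-Reasoning

    vanishes-somewhere : ∀ {M x a} (ι : Fin (suc M) → Fin N) → (∀ i → ρ (ι i) < 0ℚ) →
      (∀ j → (∃ λ i → j ≡ ι i) ⊎ 0ℚ ≤ ρ j) →
      (∀ j → 0ℚ ≤ a j) → Represents x a → ∃ λ i → Cone (_≡ ι i) x
    vanishes-somewhere {M} {x} {a} ι ρι<0 signs a≥0 rep =
      proj₁ (minimizer ratio) , cone-at-minimizer (proj₁ (minimizer ratio)) (proj₂ (minimizer ratio))
      where
      instance
        ρι-nonZero : ∀ {i} → NonZero (ρ (ι i))
        ρι-nonZero {i} = neg⇒nonZero (ρ (ι i)) {{negative (ρι<0 i)}}
      -- adding ratio i times ρ is the largest step that keeps the ι i coefficient nonnegative
      ratio : Fin (suc M) → ℚ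
      ratio i = - (a (ι i) * 1/ ρ (ι i))
      ratio*ρ : ∀ i → ratio i * ρ (ι i) ≡ - a (ι i)
      ratio*ρ i = begin
        - (a (ι i) * 1/ ρ (ι i)) * ρ (ι i)   ≡⟨ neg-distribˡ-* (a (ι i) * 1/ ρ (ι i)) (ρ (ι i)) ⟨
        - (a (ι i) * 1/ ρ (ι i) * ρ (ι i))   ≡⟨ cong -_ (*-assoc (a (ι i)) (1/ ρ (ι i)) (ρ (ι i))) ⟩
        - (a (ι i) * (1/ ρ (ι i) * ρ (ι i))) ≡⟨ cong (λ y → - (a (ι i) * y)) (*-inverseˡ (ρ (ι i))) ⟩
        - (a (ι i) * 1ℚ)                     ≡⟨ cong -_ (*-identityʳ (a (ι i))) ⟩
        - a (ι i)                            ∎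
        where open ≡-Reasoning
      cone-at-minimizer : ∀ i* → (∀ i → ratio i* ≤ ratio i) → Cone (_≡ ι i*) x
      cone-at-minimizer i* t≤ratio = a′ , a′≥0 , a′≡0 , Represents-shift {a = a} t rep
        where
        t = ratio i*
        t≥0 : 0ℚ ≤ t
        t≥0 = *-cancelʳ-≤-neg (ρ (ι i*)) {{negative (ρι<0 i*)}} (begin
          t * ρ (ι i*)  ≡⟨ ratio*ρ i* ⟩
          - a (ι i*)    ≤⟨ neg-antimono-≤ (a≥0 (ι i*)) ⟩
          - 0ℚ          ≡⟨ *-zeroˡ (ρ (ι i*)) ⟨
          0ℚ * ρ (ι i*) ∎)
          where open ≤-Reasoning
        a′ : Fin N → ℚ
        a′ j = a j + t * ρ j
        a′≥0 : ∀ j → 0ℚ ≤ a′ j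
        a′≥0 j with signs j
        ... | inj₂ ρj≥0 = begin
          0ℚ            ≡⟨ +-identityʳ 0ℚ ⟨
          0ℚ + 0ℚ       ≤⟨ +-mono-≤ (a≥0 j) tρj≥0 ⟩
          a j + t * ρ j ∎
          where
          open ≤-Reasoning
          tρj≥0 : 0ℚ ≤ t * ρ j
          tρj≥0 = subst (_≤ t * ρ j) (*-zeroˡ (ρ j)) (*-monoʳ-≤-nonNeg (ρ j) {{nonNegative ρj≥0}} t≥0)
        ... | inj₁ (i , refl) = begin
          0ℚ                          ≡⟨ +-inverseʳ (a (ι i)) ⟨
          a (ι i) + - a (ι i)         ≡⟨ cong (_+_ (a (ι i))) (ratio*ρ i) ⟨
          a (ι i) + ratio i * ρ (ι i) ≤⟨ +-monoʳ-≤ (a (ι i))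
                                          (*-monoʳ-≤-nonPos (ρ (ι i)) {{nonPositive (<⇒≤ (ρι<0 i))}} (t≤ratio i)) ⟩
          a (ι i) + t * ρ (ι i)       ∎
          where open ≤-Reasoning
        a′≡0 : ∀ j → j ≡ ι i* → a′ j ≡ 0ℚ
        a′≡0 _ refl = trans (cong (_+_ (a (ι i*))) (ratio*ρ i*)) (+-inverseʳ (a (ι i*)))

module AlternatingSums where

  open import Data.Bool using (Bool; true; false; if_then_else_)
  open import Data.Nat as ℕ using (zero; suc; _∸_; _≟_)
  import Data.Nat.Properties as ℕ
  open import Data.Integer as ℤ using (ℤ; +_; -_; _+_; _*_; _^_; _-_; -1ℤ)
  import Data.Integer.Properties as ℤ
  open import Data.Integer.Solver using (module +-*-Solver)
  open import Data.Fin using (suc)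
  open import Data.Fin.Subset using (Subset; ⊤; ∁; ∣_∣; Nonempty) renaming (_∈_ to _∈ₛ_)
  open import Data.Fin.Subset.Properties using (_⊆?_; ∣p∣≤n; drop-there; ∈⊤; x∈∁p⇒x∉p)
  open import Data.Vec using ([]; _∷_)
  open import Data.List as List using (List; []; _∷_; map; filter; upTo; length)
  open import Data.List.Properties using (map-cong; map-cong-local; map-++; map-∘; upTo-∷ʳ)
  open import Data.List.Relation.Unary.All.Properties using (applyUpTo⁺₁)
  open import Data.List.Membership.Propositional using (_∈_)
  open import Data.List.Relation.Unary.Any using (here; there)
  open import Relation.Nullary using (does)
  open import Relation.Nullary.Decidable using (dec-true; dec-false)
  open import Relation.Unary using (Decidable)
  open +-*-Solver

  𝟙 : Bool → ℕ
  𝟙 b = if b then 1 else 0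

  sumℤ-++ : ∀ xs ys → sumℤ (xs List.++ ys) ≡ sumℤ xs + sumℤ ys
  sumℤ-++ []       ys = sym (ℤ.+-identityˡ _)
  sumℤ-++ (x ∷ xs) ys = trans (cong (_+_ x) (sumℤ-++ xs ys)) (sym (ℤ.+-assoc x _ _))

  private variable
    A B : Set

  sumℤ-cong : ∀ {f g : A → ℤ} xs → (∀ x → f x ≡ g x) → sumℤ (map f xs) ≡ sumℤ (map g xs)
  sumℤ-cong xs f≗g = cong sumℤ (map-cong f≗g xs)

  sumℤ-zero : ∀ (f : A → ℤ) xs → (∀ x → f x ≡ + 0) → sumℤ (map f xs) ≡ + 0
  sumℤ-zero f []       f≗0 = refl
  sumℤ-zero f (x ∷ xs) f≗0 = cong₂ _+_ (f≗0 x) (sumℤ-zero f xs f≗0)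

  sumℤ-+ : ∀ (f g : A → ℤ) xs →
    sumℤ (map (λ x → f x + g x) xs) ≡ sumℤ (map f xs) + sumℤ (map g xs)
  sumℤ-+ f g []       = refl
  sumℤ-+ f g (x ∷ xs) = trans (cong (_+_ (f x + g x)) (sumℤ-+ f g xs))
    (solve 4 (λ a b c d → (a :+ b) :+ (c :+ d) := (a :+ c) :+ (b :+ d)) refl (f x) (g x) _ _)

  sumℤ-*ˡ : ∀ c (f : A → ℤ) xs → sumℤ (map (λ x → c * f x) xs) ≡ c * sumℤ (map f xs)
  sumℤ-*ˡ c f []       = sym (ℤ.*-zeroʳ c)
  sumℤ-*ˡ c f (x ∷ xs) =
    trans (cong (_+_ (c * f x)) (sumℤ-*ˡ c f xs)) (sym (ℤ.*-distribˡ-+ c (f x) _))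

  sumℤ-*ʳ : ∀ c (f : A → ℤ) xs → sumℤ (map (λ x → f x * c) xs) ≡ sumℤ (map f xs) * c
  sumℤ-*ʳ c f xs = trans (sumℤ-cong xs (λ x → ℤ.*-comm (f x) c))
                         (trans (sumℤ-*ˡ c f xs) (ℤ.*-comm c _))

  sumℤ-comm : ∀ (g : A → B → ℤ) xs ys →
    sumℤ (map (λ x → sumℤ (map (g x) ys)) xs) ≡ sumℤ (map (λ y → sumℤ (map (λ x → g x y) xs)) ys)
  sumℤ-comm g []       ys = sym (sumℤ-zero _ ys (λ _ → refl))
  sumℤ-comm g (x ∷ xs) ys =
    trans (cong (_+_ (sumℤ (map (g x) ys))) (sumℤ-comm g xs ys)) (sym (sumℤ-+ (g x) _ ys))

  sumℤ-filter : ∀ {P : A → Set} (P? : Decidable P) (F : A → ℤ) xs →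
    sumℤ (map F (filter P? xs)) ≡ sumℤ (map (λ x → + 𝟙 (does (P? x)) * F x) xs)
  sumℤ-filter P? F [] = refl
  sumℤ-filter P? F (x ∷ xs) with does (P? x)
  ... | true  = cong₂ _+_ (sym (ℤ.*-identityˡ (F x))) (sumℤ-filter P? F xs)
  ... | false = trans (sumℤ-filter P? F xs) (sym (trans (cong (_+ rest) (ℤ.*-zeroˡ (F x))) (ℤ.+-identityˡ rest)))
    where rest = sumℤ (map (λ x → + 𝟙 (does (P? x)) * F x) xs)

  sumℤ-upTo-suc : ∀ (g : ℕ → ℤ) M → sumℤ (map g (upTo (suc M))) ≡ sumℤ (map g (upTo M)) + g M
  sumℤ-upTo-suc g M = begin
    sumℤ (map g (upTo (suc M)))              ≡⟨ cong (sumℤ ∘ map g) (upTo-∷ʳ M) ⟨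
    sumℤ (map g (upTo M List.∷ʳ M))          ≡⟨ cong sumℤ (map-++ g (upTo M) (M ∷ [])) ⟩
    sumℤ (map g (upTo M) List.++ (g M ∷ [])) ≡⟨ sumℤ-++ (map g (upTo M)) (g M ∷ []) ⟩
    sumℤ (map g (upTo M)) + (g M + + 0)      ≡⟨ cong (_+_ (sumℤ (map g (upTo M)))) (ℤ.+-identityʳ (g M)) ⟩
    sumℤ (map g (upTo M)) + g M              ∎
    where open ≡-Reasoning

  sumℤ-upTo-𝟙-outside : ∀ (h : ℕ → ℤ) j M → M ℕ.≤ j →
    sumℤ (map (λ k → h k * + 𝟙 (does (j ≟ k))) (upTo M)) ≡ + 0
  sumℤ-upTo-𝟙-outside h j zero    M≤j = refl
  sumℤ-upTo-𝟙-outside h j (suc M) M<j = begin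
    sumℤ (map (λ k → h k * + 𝟙 (does (j ≟ k))) (upTo (suc M)))
      ≡⟨ sumℤ-upTo-suc _ M ⟩
    sumℤ (map (λ k → h k * + 𝟙 (does (j ≟ k))) (upTo M)) + h M * + 𝟙 (does (j ≟ M))
      ≡⟨ cong₂ _+_ (sumℤ-upTo-𝟙-outside h j M (ℕ.<⇒≤ M<j))
                   (cong (λ b → h M * + 𝟙 b) (dec-false (j ≟ M) (ℕ.>⇒≢ M<j))) ⟩
    + 0 + h M * + 0
      ≡⟨ cong (_+_ (+ 0)) (ℤ.*-zeroʳ (h M)) ⟩
    + 0 ∎
    where open ≡-Reasoning

  sumℤ-upTo-𝟙 : ∀ (h : ℕ → ℤ) j M → j ℕ.< M →
    sumℤ (map (λ k → h k * + 𝟙 (does (j ≟ k))) (upTo M)) ≡ h j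
  sumℤ-upTo-𝟙 h j (suc M) j<1+M =
    trans (sumℤ-upTo-suc _ M) (last-term (ℕ.m≤n⇒m<n∨m≡n (ℕ.s≤s⁻¹ j<1+M)))
    where
    last-term : j ℕ.< M ⊎ j ≡ M →
      sumℤ (map (λ k → h k * + 𝟙 (does (j ≟ k))) (upTo M)) + h M * + 𝟙 (does (j ≟ M)) ≡ h j
    last-term (inj₁ j<M) =
      trans (cong₂ _+_ (sumℤ-upTo-𝟙 h j M j<M) (cong (λ b → h M * + 𝟙 b) (dec-false (j ≟ M) (ℕ.<⇒≢ j<M))))
            (trans (cong (_+_ (h j)) (ℤ.*-zeroʳ (h M))) (ℤ.+-identityʳ (h j)))
    last-term (inj₂ refl) =
      trans (cong₂ _+_ (sumℤ-upTo-𝟙-outside h j j ℕ.≤-refl) (cong (λ b → h j * + 𝟙 b) (dec-true (j ≟ j) refl)))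
            (trans (ℤ.+-identityˡ _) (ℤ.*-identityʳ (h j)))

  sumℤ-by-size : ∀ {m} (g : ℕ → ℤ) (F : Subset m → ℤ) Ts →
    sumℤ (map (λ T → g ∣ T ∣ * F T) Ts)
      ≡ sumℤ (map (λ k → g k * sumℤ (map F (filter (λ T → ∣ T ∣ ≟ k) Ts))) (upTo (suc m)))
  sumℤ-by-size {m} g F Ts = begin
    sumℤ (map (λ T → g ∣ T ∣ * F T) Ts)
      ≡⟨ sumℤ-cong Ts (λ T → cong (_* F T) (sym (sumℤ-upTo-𝟙 g ∣ T ∣ (suc m) (ℕ.s≤s (∣p∣≤n T))))) ⟩
    sumℤ (map (λ T → sumℤ (map (λ k → g k * 𝟙≟ T k) (upTo (suc m))) * F T) Ts)
      ≡⟨ sumℤ-cong Ts (λ T → sym (sumℤ-*ʳ (F T) (λ k → g k * 𝟙≟ T k) (upTo (suc m)))) ⟩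
    sumℤ (map (λ T → sumℤ (map (λ k → g k * 𝟙≟ T k * F T) (upTo (suc m)))) Ts)
      ≡⟨ sumℤ-comm (λ T k → g k * 𝟙≟ T k * F T) Ts (upTo (suc m)) ⟩
    sumℤ (map (λ k → sumℤ (map (λ T → g k * 𝟙≟ T k * F T) Ts)) (upTo (suc m)))
      ≡⟨ sumℤ-cong (upTo (suc m)) (λ k → trans (sumℤ-cong Ts (λ T → ℤ.*-assoc (g k) (𝟙≟ T k) (F T)))
                                                (sumℤ-*ˡ (g k) (λ T → 𝟙≟ T k * F T) Ts)) ⟩
    sumℤ (map (λ k → g k * sumℤ (map (λ T → 𝟙≟ T k * F T) Ts)) (upTo (suc m)))
      ≡⟨ sumℤ-cong (upTo (suc m)) (λ k → cong (g k *_) (sym (sumℤ-filter (λ T → ∣ T ∣ ≟ k) F Ts))) ⟩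
    sumℤ (map (λ k → g k * sumℤ (map F (filter (λ T → ∣ T ∣ ≟ k) Ts))) (upTo (suc m))) ∎
    where
    open ≡-Reasoning
    𝟙≟ : Subset m → ℕ → ℤ
    𝟙≟ T k = + 𝟙 (does (∣ T ∣ ≟ k))

  sumℤ-allSubsets-suc : ∀ m (F : Subset (suc m) → ℤ) →
    sumℤ (map F (allSubsets (suc m)))
      ≡ sumℤ (map (λ T → F (true ∷ T)) (allSubsets m)) + sumℤ (map (λ T → F (false ∷ T)) (allSubsets m))
  sumℤ-allSubsets-suc m F = begin
    sumℤ (map F (map (true ∷_) (allSubsets m) List.++ map (false ∷_) (allSubsets m)))
      ≡⟨ cong sumℤ (map-++ F (map (true ∷_) (allSubsets m)) _) ⟩
    sumℤ (map F (map (true ∷_) (allSubsets m)) List.++ map F (map (false ∷_) (allSubsets m)))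
      ≡⟨ sumℤ-++ (map F (map (true ∷_) (allSubsets m))) _ ⟩
    sumℤ (map F (map (true ∷_) (allSubsets m))) + sumℤ (map F (map (false ∷_) (allSubsets m)))
      ≡⟨ cong₂ _+_ (cong sumℤ (sym (map-∘ (allSubsets m)))) (cong sumℤ (sym (map-∘ (allSubsets m)))) ⟩
    sumℤ (map (λ T → F (true ∷ T)) (allSubsets m)) + sumℤ (map (λ T → F (false ∷ T)) (allSubsets m)) ∎
    where open ≡-Reasoning

  sumℤ-full-size : ∀ m (F : Subset m → ℤ) →
    sumℤ (map (λ T → + 𝟙 (does (∣ T ∣ ≟ m)) * F T) (allSubsets m)) ≡ F ⊤
  sumℤ-full-size zero    F = trans (ℤ.+-identityʳ _) (ℤ.*-identityˡ (F []))
  sumℤ-full-size (suc m) F = begin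
    sumℤ (map (λ T → + 𝟙 (does (∣ T ∣ ≟ suc m)) * F T) (allSubsets (suc m)))
      ≡⟨ sumℤ-allSubsets-suc m _ ⟩
    sumℤ (map (λ T → + 𝟙 (does (∣ T ∣ ≟ m)) * F (true ∷ T)) (allSubsets m))
      + sumℤ (map (λ T → + 𝟙 (does (∣ T ∣ ≟ suc m)) * F (false ∷ T)) (allSubsets m))
      ≡⟨ cong₂ _+_ (sumℤ-full-size m (λ T → F (true ∷ T))) (sumℤ-zero _ (allSubsets m) too-small) ⟩
    F ⊤ + + 0 ≡⟨ ℤ.+-identityʳ (F ⊤) ⟩
    F ⊤       ∎
    where
    open ≡-Reasoning
    too-small : ∀ T → + 𝟙 (does (∣ T ∣ ≟ suc m)) * F (false ∷ T) ≡ + 0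
    too-small T = trans
      (cong (λ b → + 𝟙 b * F (false ∷ T)) (dec-false (∣ T ∣ ≟ suc m) (ℕ.<⇒≢ (ℕ.s≤s (∣p∣≤n T)))))
      (ℤ.*-zeroˡ (F (false ∷ T)))

  -1^-suc : ∀ m {e} → e ℕ.≤ m → -1ℤ ^ (suc m ∸ e) ≡ -1ℤ * -1ℤ ^ (m ∸ e)
  -1^-suc m e≤m = cong (-1ℤ ^_) (ℕ.+-∸-assoc 1 e≤m)

  signedSubsetSum : ∀ m → (Subset m → ℕ) → ℤ
  signedSubsetSum m f = sumℤ (map (λ T → -1ℤ ^ (m ∸ ∣ T ∣) * + f T) (allSubsets m))

  altSubsetSum≡top-signed : ∀ m f → altSubsetSum m f ≡ + f ⊤ - signedSubsetSum m f
  altSubsetSum≡top-signed m f =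
    trans (solve 2 (λ a x → a := x :- (:- a :+ x)) refl (altSubsetSum m f) (+ f ⊤))
          (cong (_-_ (+ f ⊤)) (sym signed≡))
    where
    open ≡-Reasoning
    S : ℕ → ℤ
    S k = sumℤ (map (λ T → + f T) (filter (λ T → ∣ T ∣ ≟ k) (allSubsets m)))
    sign-step : ∀ {k} → k ℕ.< m → -1ℤ ^ (m ∸ k) * S k ≡ -1ℤ * (-1ℤ ^ (m ∸ 1 ∸ k) * S k)
    sign-step {k} (ℕ.s≤s k≤m′) =
      trans (cong (_* S k) (-1^-suc _ k≤m′)) (ℤ.*-assoc -1ℤ (-1ℤ ^ (m ∸ 1 ∸ k)) (S k))
    signed≡ : signedSubsetSum m f ≡ - altSubsetSum m f + + f ⊤
    signed≡ = begin
      signedSubsetSum m f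
        ≡⟨ sumℤ-by-size (λ k → -1ℤ ^ (m ∸ k)) (λ T → + f T) (allSubsets m) ⟩
      sumℤ (map (λ k → -1ℤ ^ (m ∸ k) * S k) (upTo (suc m)))
        ≡⟨ sumℤ-upTo-suc (λ k → -1ℤ ^ (m ∸ k) * S k) m ⟩
      sumℤ (map (λ k → -1ℤ ^ (m ∸ k) * S k) (upTo m)) + -1ℤ ^ (m ∸ m) * S m
        ≡⟨ cong₂ _+_ (cong sumℤ (map-cong-local (applyUpTo⁺₁ id m sign-step)))
                     (cong (λ e → -1ℤ ^ e * S m) (ℕ.n∸n≡0 m)) ⟩
      sumℤ (map (λ k → -1ℤ * (-1ℤ ^ (m ∸ 1 ∸ k) * S k)) (upTo m)) + + 1 * S m
        ≡⟨ cong₂ _+_ (sumℤ-*ˡ -1ℤ (λ k → -1ℤ ^ (m ∸ 1 ∸ k) * S k) (upTo m)) (ℤ.*-identityˡ (S m)) ⟩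
      -1ℤ * altSubsetSum m f + S m
        ≡⟨ cong₂ _+_ (ℤ.-1*i≡-i (altSubsetSum m f))
                     (trans (sumℤ-filter (λ T → ∣ T ∣ ≟ m) (λ T → + f T) (allSubsets m))
                            (sumℤ-full-size m (λ T → + f T))) ⟩
      - altSubsetSum m f + + f ⊤ ∎

  -- Split on the first index: if it lies in B, the subsets with and without it cancel;
  -- otherwise every contributing T contains it and we recurse on the rest of B.
  signedSubsetSum-⊆ : ∀ {m} (B : Subset m) → Nonempty B →
    signedSubsetSum m (λ T → 𝟙 (does (∁ T ⊆? B))) ≡ + 0
  signedSubsetSum-⊆ {suc m} (b ∷ B) (i , i∈b∷B) =
    trans (sumℤ-allSubsets-suc m _) (split b i i∈b∷B)
    where
    open ≡-Reasoning
    χ : Subset m → ℤ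
    χ T = + 𝟙 (does (∁ T ⊆? B))
    s = signedSubsetSum m (λ T → 𝟙 (does (∁ T ⊆? B)))
    split : ∀ b i → i ∈ₛ b ∷ B →
      s + sumℤ (map (λ T → -1ℤ ^ (suc m ∸ ∣ T ∣) * + 𝟙 (does (∁ (false ∷ T) ⊆? b ∷ B))) (allSubsets m)) ≡ + 0
    split true _ _ = begin
      s + sumℤ (map (λ T → -1ℤ ^ (suc m ∸ ∣ T ∣) * χ T) (allSubsets m))
        ≡⟨ cong (_+_ s) (sumℤ-cong (allSubsets m) (λ T →
             trans (cong (_* χ T) (-1^-suc m (∣p∣≤n T))) (ℤ.*-assoc -1ℤ (-1ℤ ^ (m ∸ ∣ T ∣)) (χ T)))) ⟩
      s + sumℤ (map (λ T → -1ℤ * (-1ℤ ^ (m ∸ ∣ T ∣) * χ T)) (allSubsets m))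
        ≡⟨ cong (_+_ s) (sumℤ-*ˡ -1ℤ (λ T → -1ℤ ^ (m ∸ ∣ T ∣) * χ T) (allSubsets m)) ⟩
      s + -1ℤ * s ≡⟨ solve 1 (λ x → x :+ (:- con (+ 1)) :* x := con (+ 0)) refl s ⟩
      + 0 ∎
    split false (suc i) i∈B = cong₂ _+_ (signedSubsetSum-⊆ B (i , drop-there i∈B))
      (sumℤ-zero _ (allSubsets m) (λ T → ℤ.*-zeroʳ (-1ℤ ^ (suc m ∸ ∣ T ∣))))

  altSubsetSum-⊆ : ∀ {m} (B : Subset m) → Nonempty B → altSubsetSum m (λ T → 𝟙 (does (∁ T ⊆? B))) ≡ + 1
  altSubsetSum-⊆ {m} B B≢∅ = begin
    altSubsetSum m (λ T → 𝟙 (does (∁ T ⊆? B)))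
      ≡⟨ altSubsetSum≡top-signed m _ ⟩
    + 𝟙 (does (∁ ⊤ ⊆? B)) - signedSubsetSum m (λ T → 𝟙 (does (∁ T ⊆? B)))
      ≡⟨ cong₂ (λ b s → + 𝟙 b - s) (dec-true (∁ ⊤ ⊆? B) (λ x∈∁⊤ → ⊥-elim (x∈∁p⇒x∉p x∈∁⊤ ∈⊤)))
                                   (signedSubsetSum-⊆ B B≢∅) ⟩
    + 1 ∎
    where open ≡-Reasoning

  altSubsetSum-cong : ∀ m {f g : Subset m → ℕ} → (∀ T → f T ≡ g T) → altSubsetSum m f ≡ altSubsetSum m g
  altSubsetSum-cong m f≗g = sumℤ-cong (upTo m) (λ k → cong (-1ℤ ^ (m ∸ 1 ∸ k) *_)
    (sumℤ-cong (filter (λ T → ∣ T ∣ ≟ k) (allSubsets m)) (λ T → cong +_ (f≗g T))))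

  altSubsetSum-+ : ∀ m (f g : Subset m → ℕ) →
    altSubsetSum m (λ T → f T ℕ.+ g T) ≡ altSubsetSum m f + altSubsetSum m g
  altSubsetSum-+ m f g = trans (sumℤ-cong (upTo m) (λ k →
      trans (cong (-1ℤ ^ (m ∸ 1 ∸ k) *_)
                  (sumℤ-+ (λ T → + f T) (λ T → + g T) (filter (λ T → ∣ T ∣ ≟ k) (allSubsets m))))
            (ℤ.*-distribˡ-+ (-1ℤ ^ (m ∸ 1 ∸ k)) _ _)))
    (sumℤ-+ _ _ (upTo m))

  length-filter-∷ : ∀ {P : A → Set} (P? : Decidable P) x xs →
    length (filter P? (x ∷ xs)) ≡ 𝟙 (does (P? x)) ℕ.+ length (filter P? xs)
  length-filter-∷ P? x xs with does (P? x)
  ... | true  = refl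
  ... | false = refl

  altSubsetSum-count : ∀ {m} (B : A → Subset m) xs → (∀ x → x ∈ xs → Nonempty (B x)) →
    altSubsetSum m (λ T → length (filter (λ x → ∁ T ⊆? B x) xs)) ≡ + length xs
  altSubsetSum-count {m = m} B [] _ = sumℤ-zero _ (upTo m) (λ k →
    trans (cong (-1ℤ ^ (m ∸ 1 ∸ k) *_) (sumℤ-zero _ (filter (λ T → ∣ T ∣ ≟ k) (allSubsets m)) (λ _ → refl)))
          (ℤ.*-zeroʳ (-1ℤ ^ (m ∸ 1 ∸ k))))
  altSubsetSum-count {m = m} B (x ∷ xs) B≢∅ = begin
    altSubsetSum m (λ T → length (filter (λ y → ∁ T ⊆? B y) (x ∷ xs)))
      ≡⟨ altSubsetSum-cong m (λ T → length-filter-∷ (λ y → ∁ T ⊆? B y) x xs) ⟩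
    altSubsetSum m (λ T → 𝟙 (does (∁ T ⊆? B x)) ℕ.+ length (filter (λ y → ∁ T ⊆? B y) xs))
      ≡⟨ altSubsetSum-+ m _ _ ⟩
    altSubsetSum m (λ T → 𝟙 (does (∁ T ⊆? B x))) + altSubsetSum m (λ T → length (filter (λ y → ∁ T ⊆? B y) xs))
      ≡⟨ cong₂ _+_ (altSubsetSum-⊆ (B x) (B≢∅ x (here refl)))
                   (altSubsetSum-count B xs (λ y y∈xs → B≢∅ y (there y∈xs))) ⟩
    + suc (length xs) ∎
    where open ≡-Reasoning

module Generators (r' s' : ℕ) (p : Vec ℕ (suc r')) (q : Vec ℕ (suc s')) where

  open import Data.Bool using (true; false)
  open import Data.Nat as ℕ using (zero; suc; _+_; _≡ᵇ_)
  import Data.Nat.Properties as ℕ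
  open import Data.Integer as ℤ using (ℤ; +_)
  import Data.Integer.Properties as ℤ
  open import Data.Fin as Fin using (zero; suc; toℕ; inject₁; fromℕ; _↑ˡ_; _↑ʳ_)
  import Data.Fin.Properties as Fin
  open import Data.Vec as Vec using (Vec; _∷_; _∷ʳ_; lookup; last; init; sum; _++_; cast)
  import Data.Vec.Properties as Vec
  open import Data.Rational as ℚ using (0ℚ; 1ℚ; _*_; _<_)
  import Data.Rational.Properties as ℚ
  open import Data.Rational.Solver using (module +-*-Solver)
  open import Relation.Nullary using (yes; no)
  open import Relation.Nullary.Decidable using (dec-true; dec-false)
  open +-*-Solver
  open Setting r' s' p q
  open Rational using (toℚ-neg; 0<⇒0<toℚ; 0<⇒toℚ-neg<0)
  open FiniteSums using (Σℚ-cong; Σℚ-init-last; Σℚ-single; Σℚ-toℚ-++; Σℚ-toℚ-map-+; Σℚ-toℚ-map-neg)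
  open Vectors

  E : Fin (suc n) → Fin n → ℚ
  E j c = toℚ (lookup (e j) c)

  open ConeWithRelation E public

  private
    ≡ᵇ-true : ∀ {a b} → a ≡ b → (a ≡ᵇ b) ≡ true
    ≡ᵇ-true {a} {b} = dec-true (a ℕ.≟ b)

    ≡ᵇ-false : ∀ {a b} → a ≢ b → (a ≡ᵇ b) ≡ false
    ≡ᵇ-false {a} {b} = dec-false (a ℕ.≟ b)

  eₙ-tail : Vec ℤ (r' + s')
  eₙ-tail = Vec.map +_ (init p) ++ Vec.map (λ x → ℤ.- (+ x)) (init q)

  lookup-eₙ : ∀ c → lookup eₙ c ≡ lookup (+ 1 ∷ eₙ-tail) (Fin.cast (ℕ.+-suc r' s') c)
  lookup-eₙ = Vec.lookup-cast₁ (sym (ℕ.+-suc r' s')) (+ 1 ∷ eₙ-tail)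

  eₙ-first : ∀ c → toℕ c ≡ 0 → lookup eₙ c ≡ + 1
  eₙ-first c c≡0 = trans (lookup-eₙ c)
    (cong (lookup (+ 1 ∷ eₙ-tail)) (Fin.toℕ-injective {j = zero} (trans (Fin.toℕ-cast _ c) c≡0)))

  genCoord-first : ∀ j c → toℕ c ≡ 0 → genCoord j c ≡ + 1
  genCoord-first j c c≡0 with toℕ j ≡ᵇ n
  ... | true  = eₙ-first c c≡0
  ... | false rewrite ≡ᵇ-true c≡0 = refl

  genCoord-last : ∀ c → genCoord (fromℕ n) c ≡ lookup eₙ c
  genCoord-last c rewrite ≡ᵇ-true (Fin.toℕ-fromℕ n) = refl

  genCoord-diagonal : ∀ c → toℕ c ≢ 0 → genCoord (inject₁ c) c ≡ + 1
  genCoord-diagonal c c≢0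
    rewrite ≡ᵇ-false (Fin.toℕ-inject₁-≢ c ∘ sym) | ≡ᵇ-false c≢0 | ≡ᵇ-true (sym (Fin.toℕ-inject₁ c)) = refl

  genCoord-off-diagonal : ∀ c′ c → toℕ c ≢ 0 → c′ ≢ c → genCoord (inject₁ c′) c ≡ + 0
  genCoord-off-diagonal c′ c c≢0 c′≢c
    rewrite ≡ᵇ-false (Fin.toℕ-inject₁-≢ c′ ∘ sym) | ≡ᵇ-false c≢0
          | ≡ᵇ-false {toℕ c} (λ e → c′≢c (Fin.toℕ-injective (trans (sym (Fin.toℕ-inject₁ c′)) (sym e)))) = refl

  E≡genCoord : ∀ j c → E j c ≡ toℚ (genCoord j c)
  E≡genCoord j c = cong toℚ (Vec.lookup∘tabulate (genCoord j) c)

  combination-first : ∀ a c → toℕ c ≡ 0 → combination a c ≡ Σℚ a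
  combination-first a c c≡0 = Σℚ-cong (λ j →
    trans (cong (a j *_) (trans (E≡genCoord j c) (cong toℚ (genCoord-first j c c≡0)))) (ℚ.*-identityʳ (a j)))

  combination-other : ∀ a c → toℕ c ≢ 0 →
    combination a c ≡ a (inject₁ c) ℚ.+ a (fromℕ n) * toℚ (lookup eₙ c)
  combination-other a c c≢0 = trans (Σℚ-init-last (λ j → a j * E j c))
    (cong₂ ℚ._+_ (trans (Σℚ-single _ c off-diagonal) diagonal) last-column)
    where
    off-diagonal : ∀ c′ → c′ ≢ c → a (inject₁ c′) * E (inject₁ c′) c ≡ 0ℚ
    off-diagonal c′ c′≢c = trans
      (cong (a (inject₁ c′) *_) (trans (E≡genCoord (inject₁ c′) c) (cong toℚ (genCoord-off-diagonal c′ c c≢0 c′≢c))))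
      (ℚ.*-zeroʳ (a (inject₁ c′)))
    diagonal : a (inject₁ c) * E (inject₁ c) c ≡ a (inject₁ c)
    diagonal = trans
      (cong (a (inject₁ c) *_) (trans (E≡genCoord (inject₁ c) c) (cong toℚ (genCoord-diagonal c c≢0))))
      (ℚ.*-identityʳ (a (inject₁ c)))
    last-column : a (fromℕ n) * E (fromℕ n) c ≡ a (fromℕ n) * toℚ (lookup eₙ c)
    last-column = cong (a (fromℕ n) *_) (trans (E≡genCoord (fromℕ n) c) (cong toℚ (genCoord-last c)))

  relation₊ : Vec ℤ (suc r')
  relation₊ = Vec.map (λ x → ℤ.- (+ x)) (last p ∷ init p)

  relation₋ : Vec ℤ (suc s')
  relation₋ = Vec.map +_ q

  relation : Vec ℤ (suc n)
  relation = relation₊ ++ relation₋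

  ρ : Fin (suc n) → ℚ
  ρ j = toℚ (lookup relation j)

  -- the first n entries of relation, written in the same cast-of-a-cons shape as eₙ
  relation-init : Vec ℤ n
  relation-init = cast (sym (ℕ.+-suc r' s')) (ℤ.- (+ last p) ∷ Vec.map ℤ.-_ eₙ-tail)

  relation-∷ʳ : relation ≡ relation-init ∷ʳ + last q
  relation-∷ʳ = begin
    (ℤ.- (+ last p) ∷ P) ++ Vec.map +_ q
      ≡⟨ cong (λ v → (ℤ.- (+ last p) ∷ P) ++ Vec.map +_ v) (init∷ʳlast q) ⟩
    (ℤ.- (+ last p) ∷ P) ++ Vec.map +_ (init q ∷ʳ last q)
      ≡⟨ cong (λ v → ℤ.- (+ last p) ∷ (P ++ v)) (Vec.map-∷ʳ +_ (last q) (init q)) ⟩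
    ℤ.- (+ last p) ∷ (P ++ (Q ∷ʳ + last q))
      ≡⟨ cong (ℤ.- (+ last p) ∷_) (sym (Vec.++-∷ʳ-eqFree (+ last q) P Q)) ⟩
    ℤ.- (+ last p) ∷ cast (sym (ℕ.+-suc r' s')) ((P ++ Q) ∷ʳ + last q)
      ≡⟨ Vec.cast-∷ʳ (cong suc (sym (ℕ.+-suc r' s'))) (+ last q) (ℤ.- (+ last p) ∷ (P ++ Q)) ⟩
    cast (sym (ℕ.+-suc r' s')) (ℤ.- (+ last p) ∷ (P ++ Q)) ∷ʳ + last q
      ≡⟨ cong (λ v → cast (sym (ℕ.+-suc r' s')) (ℤ.- (+ last p) ∷ v) ∷ʳ + last q) (sym negated-tail) ⟩
    cast (sym (ℕ.+-suc r' s')) (ℤ.- (+ last p) ∷ Vec.map ℤ.-_ eₙ-tail) ∷ʳ + last q ∎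
    where
    open ≡-Reasoning
    P = Vec.map (λ x → ℤ.- (+ x)) (init p)
    Q = Vec.map +_ (init q)
    negated-tail : Vec.map ℤ.-_ eₙ-tail ≡ P ++ Q
    negated-tail = trans (Vec.map-++ ℤ.-_ (Vec.map +_ (init p)) _)
      (cong₂ _++_ (sym (Vec.map-∘ ℤ.-_ +_ (init p)))
                  (trans (sym (Vec.map-∘ ℤ.-_ (λ x → ℤ.- (+ x)) (init q)))
                         (Vec.map-cong (λ x → ℤ.neg-involutive (+ x)) (init q))))

  relation-last : lookup relation (fromℕ n) ≡ + last q
  relation-last =
    trans (cong (λ v → lookup v (fromℕ n)) relation-∷ʳ) (lookup-∷ʳ-last relation-init (+ last q))

  relation-other : ∀ c → toℕ c ≢ 0 → lookup relation (inject₁ c) ≡ ℤ.- lookup eₙ c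
  relation-other c c≢0 = begin
    lookup relation (inject₁ c)
      ≡⟨ cong (λ v → lookup v (inject₁ c)) relation-∷ʳ ⟩
    lookup (relation-init ∷ʳ + last q) (inject₁ c)
      ≡⟨ lookup-∷ʳ-inject₁ relation-init (+ last q) c ⟩
    lookup relation-init c
      ≡⟨ Vec.lookup-cast₁ (sym (ℕ.+-suc r' s')) (ℤ.- (+ last p) ∷ Vec.map ℤ.-_ eₙ-tail) c ⟩
    lookup (ℤ.- (+ last p) ∷ Vec.map ℤ.-_ eₙ-tail) (Fin.cast (ℕ.+-suc r' s') c)
      ≡⟨ tail-entry (Fin.cast (ℕ.+-suc r' s') c)
                    (λ c≡0 → c≢0 (trans (sym (Fin.toℕ-cast _ c)) (cong toℕ c≡0))) ⟩
    ℤ.- lookup (+ 1 ∷ eₙ-tail) (Fin.cast (ℕ.+-suc r' s') c)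
      ≡⟨ cong ℤ.-_ (lookup-eₙ c) ⟨
    ℤ.- lookup eₙ c ∎
    where
    open ≡-Reasoning
    tail-entry : ∀ d → d ≢ zero →
      lookup (ℤ.- (+ last p) ∷ Vec.map ℤ.-_ eₙ-tail) d ≡ ℤ.- lookup (+ 1 ∷ eₙ-tail) d
    tail-entry zero    d≢0 = ⊥-elim (d≢0 refl)
    tail-entry (suc d) _   = Vec.lookup-map d ℤ.-_ eₙ-tail

  relation-sum : sum p ≡ sum q → Σℚ ρ ≡ 0ℚ
  relation-sum Σp≡Σq = begin
    Σℚ ρ
      ≡⟨ Σℚ-toℚ-++ relation₊ relation₋ ⟩
    Σℚ (λ i → toℚ (lookup relation₊ i)) ℚ.+ Σℚ (λ i → toℚ (lookup relation₋ i))
      ≡⟨ cong₂ ℚ._+_ (Σℚ-toℚ-map-neg (last p ∷ init p)) (Σℚ-toℚ-map-+ q) ⟩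
    ℚ.- toℚ (+ (last p + sum (init p))) ℚ.+ toℚ (+ sum q)
      ≡⟨ cong (λ x → ℚ.- toℚ (+ x) ℚ.+ toℚ (+ sum q)) Σrotated≡Σq ⟩
    ℚ.- toℚ (+ sum q) ℚ.+ toℚ (+ sum q)
      ≡⟨ ℚ.+-inverseˡ (toℚ (+ sum q)) ⟩
    0ℚ ∎
    where
    open ≡-Reasoning
    Σrotated≡Σq : last p + sum (init p) ≡ sum q
    Σrotated≡Σq = begin
      last p + sum (init p)     ≡⟨ ℕ.+-comm (last p) (sum (init p)) ⟩
      sum (init p) + last p     ≡⟨ sum-∷ʳ (init p) (last p) ⟨
      sum (init p ∷ʳ last p)    ≡⟨ cong sum (init∷ʳlast p) ⟨
      sum p                     ≡⟨ Σp≡Σq ⟩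
      sum q                     ∎

  ρ-last : last q ≡ 1 → ρ (fromℕ n) ≡ 1ℚ
  ρ-last q-last = cong toℚ (trans relation-last (cong +_ q-last))

  ρ-kernel : sum p ≡ sum q → last q ≡ 1 → ∀ c → combination ρ c ≡ 0ℚ
  ρ-kernel Σp≡Σq q-last c with toℕ c ℕ.≟ 0
  ... | yes c≡0 = trans (combination-first ρ c c≡0) (relation-sum Σp≡Σq)
  ... | no  c≢0 = begin
    combination ρ c                                   ≡⟨ combination-other ρ c c≢0 ⟩
    ρ (inject₁ c) ℚ.+ ρ (fromℕ n) * toℚ (lookup eₙ c)  ≡⟨ cong₂ (λ x y → x ℚ.+ y * toℚ (lookup eₙ c))
                                                              (cong toℚ (relation-other c c≢0)) (ρ-last q-last) ⟩
    toℚ (ℤ.- lookup eₙ c) ℚ.+ 1ℚ * toℚ (lookup eₙ c)  ≡⟨ cong₂ ℚ._+_ (toℚ-neg (lookup eₙ c)) (ℚ.*-identityˡ _) ⟩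
    ℚ.- toℚ (lookup eₙ c) ℚ.+ toℚ (lookup eₙ c)       ≡⟨ ℚ.+-inverseˡ (toℚ (lookup eₙ c)) ⟩
    0ℚ                                                 ∎
    where open ≡-Reasoning

  -- e₀, …, eₙ₋₁ are linearly independent: coordinate c ≠ 0 isolates the coefficient of e_c,
  -- and then coordinate 0 isolates that of e₀.
  generators-independent : ∀ D → (∀ c → combination D c ≡ 0ℚ) → D (fromℕ n) ≡ 0ℚ → ∀ j → D j ≡ 0ℚ
  generators-independent D D-kernel Dₙ≡0 = D≡0
    where
    open ≡-Reasoning
    D-other : ∀ c → toℕ c ≢ 0 → D (inject₁ c) ≡ 0ℚ
    D-other c c≢0 = begin
      D (inject₁ c)                                      ≡⟨ ℚ.+-identityʳ _ ⟨
      D (inject₁ c) ℚ.+ 0ℚ                               ≡⟨ cong (D (inject₁ c) ℚ.+_) (ℚ.*-zeroˡ (toℚ (lookup eₙ c))) ⟨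
      D (inject₁ c) ℚ.+ 0ℚ * toℚ (lookup eₙ c)            ≡⟨ cong (λ x → D (inject₁ c) ℚ.+ x * toℚ (lookup eₙ c)) Dₙ≡0 ⟨
      D (inject₁ c) ℚ.+ D (fromℕ n) * toℚ (lookup eₙ c)   ≡⟨ combination-other D c c≢0 ⟨
      combination D c                                    ≡⟨ D-kernel c ⟩
      0ℚ                                                 ∎
    D-first : ∀ c → toℕ c ≡ 0 → D (inject₁ c) ≡ 0ℚ
    D-first c c≡0 = begin
      D (inject₁ c)
        ≡⟨ Σℚ-single (D ∘ inject₁) c
             (λ c′ c′≢c → D-other c′ (λ c′≡0 → c′≢c (Fin.toℕ-injective (trans c′≡0 (sym c≡0))))) ⟨
      Σℚ (D ∘ inject₁)                  ≡⟨ ℚ.+-identityʳ _ ⟨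
      Σℚ (D ∘ inject₁) ℚ.+ 0ℚ           ≡⟨ cong (Σℚ (D ∘ inject₁) ℚ.+_) Dₙ≡0 ⟨
      Σℚ (D ∘ inject₁) ℚ.+ D (fromℕ n)  ≡⟨ Σℚ-init-last D ⟨
      Σℚ D                              ≡⟨ combination-first D c c≡0 ⟨
      combination D c                   ≡⟨ D-kernel c ⟩
      0ℚ                                ∎
    D≡0 : ∀ j → D j ≡ 0ℚ
    D≡0 j with inject₁-or-last j
    ... | inj₂ refl = Dₙ≡0
    ... | inj₁ (c , refl) with toℕ c ℕ.≟ 0
    ...   | yes c≡0 = D-first c c≡0
    ...   | no  c≢0 = D-other c c≢0

  kernel⇒multiple : sum p ≡ sum q → last q ≡ 1 →
    ∀ D → (∀ c → combination D c ≡ 0ℚ) → ∃ λ t → ∀ j → D j ≡ t * ρ j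
  kernel⇒multiple Σp≡Σq q-last D D-kernel = t , D≡tρ
    where
    t = D (fromℕ n)
    D′ : Fin (suc n) → ℚ
    D′ j = D j ℚ.+ ℚ.- t * ρ j
    D′-kernel : ∀ c → combination D′ c ≡ 0ℚ
    D′-kernel c = begin
      combination D′ c                                ≡⟨ combination-+-* D ρ (ℚ.- t) c ⟩
      combination D c ℚ.+ ℚ.- t * combination ρ c
        ≡⟨ cong₂ (λ x y → x ℚ.+ ℚ.- t * y) (D-kernel c) (ρ-kernel Σp≡Σq q-last c) ⟩
      0ℚ ℚ.+ ℚ.- t * 0ℚ                               ≡⟨ solve 1 (λ t → con 0ℚ :+ :- t :* con 0ℚ := con 0ℚ) refl t ⟩
      0ℚ                                              ∎
      where open ≡-Reasoning
    D′ₙ≡0 : D′ (fromℕ n) ≡ 0ℚ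
    D′ₙ≡0 = trans (cong (λ x → t ℚ.+ ℚ.- t * x) (ρ-last q-last))
                  (solve 1 (λ t → t :+ :- t :* con 1ℚ := con 0ℚ) refl t)
    D≡tρ : ∀ j → D j ≡ t * ρ j
    D≡tρ j = begin
      D j                                  ≡⟨ solve 3 (λ d t r → d := (d :+ :- t :* r) :+ t :* r) refl (D j) t (ρ j) ⟩
      D′ j ℚ.+ t * ρ j                     ≡⟨ cong (ℚ._+ t * ρ j) (generators-independent D′ D′-kernel D′ₙ≡0 j) ⟩
      0ℚ ℚ.+ t * ρ j                       ≡⟨ ℚ.+-identityˡ _ ⟩
      t * ρ j                              ∎
      where open ≡-Reasoning

  last∷init-positive : (∀ i → 0 ℕ.< lookup p i) → ∀ i → 0 ℕ.< lookup (last p ∷ init p) i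
  last∷init-positive p>0 zero    = subst (0 ℕ.<_)
    (trans (cong (λ v → lookup v (fromℕ r')) (init∷ʳlast p)) (lookup-∷ʳ-last (init p) (last p))) (p>0 (fromℕ r'))
  last∷init-positive p>0 (suc i) = subst (0 ℕ.<_)
    (trans (cong (λ v → lookup v (inject₁ i)) (init∷ʳlast p)) (lookup-∷ʳ-inject₁ (init p) (last p) i)) (p>0 (inject₁ i))

  ρ-negative : (∀ i → 0 ℕ.< lookup p i) → ∀ i → ρ (i ↑ˡ suc s') < 0ℚ
  ρ-negative p>0 i =
    subst (λ z → toℚ z < 0ℚ)
          (sym (trans (Vec.lookup-++ˡ relation₊ relation₋ i) (Vec.lookup-map i (λ x → ℤ.- (+ x)) (last p ∷ init p))))
          (0<⇒toℚ-neg<0 (last∷init-positive p>0 i))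

  ρ-positive : (∀ j → 0 ℕ.< lookup q j) → ∀ i → 0ℚ < ρ (suc r' ↑ʳ i)
  ρ-positive q>0 i =
    subst (λ z → 0ℚ < toℚ z)
          (sym (trans (Vec.lookup-++ʳ relation₊ relation₋ i) (Vec.lookup-map i +_ q)))
          (0<⇒0<toℚ (q>0 i))

module Faces (r' s' : ℕ) (p : Vec ℕ (suc r')) (q : Vec ℕ (suc s')) where

  import Data.Nat as ℕ
  open import Data.Integer using (ℤ; +_)
  open import Data.Fin as Fin using (zero; _↑ˡ_; _↑ʳ_)
  open import Data.Fin.Subset using (Subset; ⊤; ∁; ⁅_⁆; Nonempty; _∈_; _∉_; _⊆_)
  open import Data.Fin.Subset.Properties
    using (_⊆?_; nonempty?; ∈⊤; x∈⁅x⁆; x∈⁅y⁆⇒x≡y; x∈∁p⇒x∉p; x∉∁p⇒x∈p; x∉p⇒x∈∁p)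
  open import Data.Vec as Vec using (lookup; tabulate; last; sum; _++_)
  import Data.Vec.Properties as Vec
  import Data.Rational.Properties as ℚ
  open import Data.Rational.Solver using (module +-*-Solver)
  open +-*-Solver
  open import Data.List using (List; filter; length)
  import Data.List.Membership.Propositional as List
  open import Data.List.Membership.Propositional.Properties using (∈-filter⁺; ∈-filter⁻)
  open import Data.List.Membership.Propositional.Properties.WithK using (unique∧set⇒bag)
  import Data.List.Membership.DecPropositional as DecMembership
  open import Data.List.Relation.Unary.Unique.Propositional.Properties using (filter⁺)
  open import Data.List.Relation.Binary.BagAndSetEquality using (∼bag⇒↭)
  open import Data.List.Relation.Binary.Permutation.Propositional.Properties using (↭-length)
  open import Data.Rational as ℚ using (0ℚ; _≤_; _<_)
  open import Data.List.Relation.Unary.Unique.Propositional using (Unique)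
  open import Function.Bundles using (Equivalence; _⇔_; mk⇔)
  open import Data.Bool using (Bool)
  open import Relation.Nullary using (yes; no; does)
  open import Relation.Nullary.Decidable using (dec-true)
  open Setting r' s' p q
  open Generators r' s' p q using (combination; Cone-mono; zero-propagates; vanishes-somewhere)
  open DecMembership (Vec.≡-dec {n = n} Data.Integer._≟_) using (_∈?_)
  open AlternatingSums using (altSubsetSum-cong; altSubsetSum-count)
  open Vectors using (↑ˡ-or-↑ʳ; ↑ˡ∈-++⁻; ↑ˡ∈-++⁺; ↑ʳ∈-++⁻; ↑ʳ∈-++⁺)

  coords : Vec ℤ n → Fin n → ℚ
  coords v c = toℚ (lookup v c)

  module _ (m : ℕ → Subset (suc n) → ℕ) (counts : ∀ k T → Nonempty T → IsCount k T (m k T)) (k : ℕ) where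

    points : ∀ W → Nonempty W → List (Vec ℤ n)
    points W W≢∅ = proj₁ (counts k W W≢∅)

    ⇒∈points : ∀ {W W≢∅ v} → PointOfWeight k W v → v List.∈ points W W≢∅
    ⇒∈points {W} {W≢∅} {v} = Equivalence.from (proj₁ (proj₂ (proj₂ (counts k W W≢∅))) v)

    ∈points⇒ : ∀ {W W≢∅ v} → v List.∈ points W W≢∅ → PointOfWeight k W v
    ∈points⇒ {W} {W≢∅} {v} = Equivalence.to (proj₁ (proj₂ (proj₂ (counts k W W≢∅))) v)

    unique-points : ∀ W W≢∅ → Unique (points W W≢∅)
    unique-points W W≢∅ = proj₁ (proj₂ (counts k W W≢∅))

    length-points : ∀ W W≢∅ → length (points W W≢∅) ≡ m k W
    length-points W W≢∅ = proj₂ (proj₂ (proj₂ (counts k W W≢∅)))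

    ⊤≢∅ : Nonempty (⊤ {suc n})
    ⊤≢∅ = zero , ∈⊤

    -- emb T is the face spanned by ι(T) and all generators outside the image of ι;
    -- σ is the relation among the generators, negative exactly on that image.
    module Side {M} (σ : Fin (suc n) → ℚ)
        (σ-kernel : ∀ c → combination σ c ≡ 0ℚ)
        (σ-multiple : ∀ D → (∀ c → combination D c ≡ 0ℚ) → ∃ λ t → ∀ j → D j ≡ t ℚ.* σ j)
        (ι : Fin (suc M) → Fin (suc n)) (σ-negative : ∀ i → σ (ι i) < 0ℚ)
        (σ-signs : ∀ j → (∃ λ i → j ≡ ι i) ⊎ 0ℚ ≤ σ j)
        (emb : Subset (suc M) → Subset (suc n)) (emb≢∅ : ∀ T → Nonempty (emb T))
        (ι∈emb⇒∈ : ∀ {T i} → ι i ∈ emb T → i ∈ T) (∈⇒ι∈emb : ∀ {T i} → i ∈ T → ι i ∈ emb T)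
        (∉emb⇒ι : ∀ {T j} → j ∉ emb T → ∃ λ i → j ≡ ι i)
        where

      facet : Fin (suc M) → Subset (suc n)
      facet i = emb (∁ ⁅ i ⁆)

      ι∉facet : ∀ i → ι i ∉ facet i
      ι∉facet i ι∈facet = x∈∁p⇒x∉p (ι∈emb⇒∈ ι∈facet) (x∈⁅x⁆ i)

      ∉facet⇒ : ∀ {i j} → j ∉ facet i → j ≡ ι i
      ∉facet⇒ {i} j∉facet with ∉emb⇒ι j∉facet
      ... | i′ , refl = cong ι (x∈⁅y⁆⇒x≡y i (x∉∁p⇒x∈p (λ i′∈ → j∉facet (∈⇒ι∈emb i′∈))))

      in-facet? : Vec ℤ n → Fin (suc M) → Bool
      in-facet? v i = does (v ∈? points (facet i) (emb≢∅ _))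

      covered : Vec ℤ n → Subset (suc M)
      covered v = tabulate (in-facet? v)

      ∈covered⇒ : ∀ {i v} → i ∈ covered v → PointOfWeight k (facet i) v
      ∈covered⇒ {i} {v} i∈ with v ∈? points (facet i) (emb≢∅ _)
                               | trans (sym (Vec.lookup∘tabulate (in-facet? v) i)) (Vec.[]=⇒lookup i∈)
      ... | yes v∈ | _  = ∈points⇒ v∈
      ... | no  _  | ()

      ⇒∈covered : ∀ {i v} → PointOfWeight k (facet i) v → i ∈ covered v
      ⇒∈covered {i} {v} pt = Vec.lookup⇒[]= i (covered v)
        (trans (Vec.lookup∘tabulate (in-facet? v) i) (dec-true (v ∈? points (facet i) (emb≢∅ _)) (⇒∈points pt)))

      face-point⇒ : ∀ {T v} → PointOfWeight k (emb T) v → v List.∈ points ⊤ ⊤≢∅ × ∁ T ⊆ covered v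
      face-point⇒ {T} (cone , weight≡k) =
        ⇒∈points (Cone-mono (λ j j∉⊤ → ⊥-elim (j∉⊤ ∈⊤)) cone , weight≡k) ,
        λ i∈∁T → ⇒∈covered (Cone-mono (λ j j∉facet → subst (_∉ emb T) (sym (∉facet⇒ j∉facet))
                                                             (x∈∁p⇒x∉p i∈∁T ∘ ι∈emb⇒∈)) cone , weight≡k)

      -- A representation vanishing at one removed index ι i₀ vanishes at every other removed index.
      face-point⇐ : ∀ {T v} → v List.∈ points ⊤ ⊤≢∅ → ∁ T ⊆ covered v → PointOfWeight k (emb T) v
      face-point⇐ {T} v∈ ∁T⊆covered with ∈points⇒ v∈ | nonempty? (∁ T)
      ... | cone , weight≡k | no ∁T≡∅ = Cone-mono outside-none cone , weight≡k
        where
        outside-none : ∀ j → j ∉ emb T → j ∉ ⊤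
        outside-none j j∉ with ∉emb⇒ι j∉
        ... | i , refl = ⊥-elim (∁T≡∅ (i , x∉p⇒x∈∁p (j∉ ∘ ∈⇒ι∈emb)))
      ... | _ , weight≡k | yes (i₀ , i₀∈∁T) with proj₁ (∈covered⇒ (∁T⊆covered i₀∈∁T))
      ...   | a , a≥0 , a≡0 , rep-a = (a , a≥0 , a-outside , rep-a) , weight≡k
        where
        a-outside : ∀ j → j ∉ emb T → a j ≡ 0ℚ
        a-outside j j∉ with ∉emb⇒ι j∉
        ... | i , refl with proj₁ (∈covered⇒ (∁T⊆covered (x∉p⇒x∈∁p (j∉ ∘ ∈⇒ι∈emb))))
        ...   | b , b≥0 , b≡0 , rep-b = zero-propagates σ σ-kernel σ-multiple (σ-negative i₀) (σ-negative i)
                  a≥0 rep-a (a≡0 (ι i₀) (ι∉facet i₀)) b≥0 rep-b (b≡0 (ι i) (ι∉facet i))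

      covered≢∅ : ∀ v → v List.∈ points ⊤ ⊤≢∅ → Nonempty (covered v)
      covered≢∅ v v∈ = nonempty (∈points⇒ v∈)
        where
        nonempty : PointOfWeight k ⊤ v → Nonempty (covered v)
        nonempty ((a , a≥0 , _ , rep) , weight≡k) =
          let i , cone = vanishes-somewhere σ σ-kernel σ-multiple {x = coords v} {a = a}
                                            ι σ-negative σ-signs a≥0 rep
          in i , ⇒∈covered (Cone-mono (λ j → ∉facet⇒) cone , weight≡k)

      face-count : ∀ T → m k (emb T) ≡ length (filter (λ v → ∁ T ⊆? covered v) (points ⊤ ⊤≢∅))
      face-count T = trans (sym (length-points (emb T) (emb≢∅ T)))
        (↭-length (∼bag⇒↭ (unique∧set⇒bag (unique-points (emb T) (emb≢∅ T))
                                           (filter⁺ (λ v → ∁ T ⊆? covered v) (unique-points ⊤ ⊤≢∅))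
                                           same-points)))
        where
        same-points : ∀ {v} →
          v List.∈ points (emb T) (emb≢∅ T) ⇔ v List.∈ filter (λ v → ∁ T ⊆? covered v) (points ⊤ ⊤≢∅)
        same-points = mk⇔
          (λ v∈ → let v∈⊤ , ∁T⊆ = face-point⇒ (∈points⇒ v∈) in ∈-filter⁺ (λ v → ∁ T ⊆? covered v) v∈⊤ ∁T⊆)
          (λ v∈ → let v∈⊤ , ∁T⊆ = ∈-filter⁻ (λ v → ∁ T ⊆? covered v) v∈ in ⇒∈points (face-point⇐ v∈⊤ ∁T⊆))

      count-by-faces : + m k ⊤ ≡ altSubsetSum (suc M) (λ T → m k (emb T))
      count-by-faces = begin
        + m k ⊤                      ≡⟨ cong +_ (length-points ⊤ ⊤≢∅) ⟨
        + length (points ⊤ ⊤≢∅)      ≡⟨ altSubsetSum-count covered (points ⊤ ⊤≢∅) covered≢∅ ⟨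
        altSubsetSum (suc M) (λ T → length (filter (λ v → ∁ T ⊆? covered v) (points ⊤ ⊤≢∅)))
                                     ≡⟨ altSubsetSum-cong (suc M) (λ T → sym (face-count T)) ⟩
        altSubsetSum (suc M) (λ T → m k (emb T)) ∎
        where open ≡-Reasoning

    open Generators r' s' p q using (ρ; ρ-kernel; kernel⇒multiple; ρ-negative; ρ-positive; combination-neg)

    m⊤≡alternating-sum-over-S₊ : (∀ i → 0 ℕ.< lookup p i) → (∀ j → 0 ℕ.< lookup q j) →
      last q ≡ 1 → sum p ≡ sum q →
      + m k ⊤ ≡ altSubsetSum (suc r') (λ T → m k (T ++ ⊤))
    m⊤≡alternating-sum-over-S₊ p>0 q>0 q-last Σp≡Σq =
      Side.count-by-faces ρ (ρ-kernel Σp≡Σq q-last) (kernel⇒multiple Σp≡Σq q-last) ι (ρ-negative p>0) signs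
        emb (λ T → suc r' ↑ʳ zero , ↑ʳ∈-++⁺ {T = T} ∈⊤) (λ {T} → ↑ˡ∈-++⁻ {T = T} {U = ⊤ {suc s'}})
        (λ {T} → ↑ˡ∈-++⁺ {T = T} {U = ⊤ {suc s'}}) outside
      where
      ι : Fin (suc r') → Fin (suc n)
      ι i = i ↑ˡ suc s'
      emb : Subset (suc r') → Subset (suc n)
      emb T = T ++ ⊤
      signs : ∀ j → (∃ λ i → j ≡ ι i) ⊎ 0ℚ ≤ ρ j
      signs j with ↑ˡ-or-↑ʳ (suc r') j
      ... | inj₁ j≡ι = inj₁ j≡ι
      ... | inj₂ (i , refl) = inj₂ (ℚ.<⇒≤ (ρ-positive q>0 i))
      outside : ∀ {T j} → j ∉ emb T → ∃ λ i → j ≡ ι i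
      outside {T} {j} j∉ with ↑ˡ-or-↑ʳ (suc r') j
      ... | inj₁ j≡ι = j≡ι
      ... | inj₂ (i , refl) = ⊥-elim (j∉ (↑ʳ∈-++⁺ {T = T} ∈⊤))

    m⊤≡alternating-sum-over-S₋ : (∀ i → 0 ℕ.< lookup p i) → (∀ j → 0 ℕ.< lookup q j) →
      last q ≡ 1 → sum p ≡ sum q →
      + m k ⊤ ≡ altSubsetSum (suc s') (λ T → m k (⊤ {suc r'} ++ T))
    m⊤≡alternating-sum-over-S₋ p>0 q>0 q-last Σp≡Σq =
      Side.count-by-faces (λ j → ℚ.- ρ j) −ρ-kernel −ρ-multiple
        ι (λ i → ℚ.neg-antimono-< (ρ-positive q>0 i)) signs
        emb (λ T → zero , ↑ˡ∈-++⁺ {U = T} ∈⊤) (λ {T} → ↑ʳ∈-++⁻ {T = ⊤ {suc r'}} {U = T})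
        (λ {T} → ↑ʳ∈-++⁺ {T = ⊤ {suc r'}} {U = T}) outside
      where
      ι : Fin (suc s') → Fin (suc n)
      ι i = suc r' ↑ʳ i
      emb : Subset (suc s') → Subset (suc n)
      emb T = ⊤ {suc r'} ++ T
      −ρ-kernel : ∀ c → combination (λ j → ℚ.- ρ j) c ≡ 0ℚ
      −ρ-kernel c = trans (combination-neg ρ c) (cong ℚ.-_ (ρ-kernel Σp≡Σq q-last c))
      −ρ-multiple : ∀ D → (∀ c → combination D c ≡ 0ℚ) → ∃ λ t → ∀ j → D j ≡ t ℚ.* ℚ.- ρ j
      −ρ-multiple D D-kernel =
        let t , D≡tρ = kernel⇒multiple Σp≡Σq q-last D D-kernel
        in ℚ.- t , λ j → trans (D≡tρ j) (solve 2 (λ t r → t :* r := :- t :* :- r) refl t (ρ j))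
      signs : ∀ j → (∃ λ i → j ≡ ι i) ⊎ 0ℚ ≤ ℚ.- ρ j
      signs j with ↑ˡ-or-↑ʳ (suc r') j
      ... | inj₁ (i , refl) = inj₂ (ℚ.<⇒≤ (ℚ.neg-antimono-< (ρ-negative p>0 i)))
      ... | inj₂ j≡ι = inj₁ j≡ι
      outside : ∀ {T j} → j ∉ emb T → ∃ λ i → j ≡ ι i
      outside {T} {j} j∉ with ↑ˡ-or-↑ʳ (suc r') j
      ... | inj₁ (i , refl) = ⊥-elim (j∉ (↑ˡ∈-++⁺ {U = T} ∈⊤))
      ... | inj₂ j≡ι = j≡ι

open import Data.Nat using (ℕ; suc; _<_)
open import Data.Vec using (Vec; lookup; last; sum; _++_)
open import Data.Fin using (Fin)
open import Data.Fin.Subset using (Subset; Nonempty; ⊤)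
open import Data.Integer using (+_)
open import Data.Product using (_×_)
open import Relation.Binary.PropositionalEquality using (_≡_; _≢_)

lemma5p1 : (r' s' : ℕ) (p : Vec ℕ (suc r')) (q : Vec ℕ (suc s')) →
    (∀ i → 0 < lookup p i) → (∀ j → 0 < lookup q j) →
    (∀ i j → lookup p i ≢ lookup q j) →
    last q ≡ 1 →
    sum p ≡ sum q →
    (m : ℕ → Subset (suc r' Data.Nat.+ suc s') → ℕ) →
    (∀ k T → Nonempty T → Setting.IsCount r' s' p q k T (m k T)) →
    ∀ k →
      (+ m k ⊤ ≡ altSubsetSum (suc r') (λ T → m k (T ++ ⊤)))
      × (+ m k ⊤ ≡ altSubsetSum (suc s') (λ T → m k (⊤ {suc r'} ++ T)))
lemma5p1 r' s' p q p>0 q>0 _ q-last Σp≡Σq m counts k =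
    m⊤≡alternating-sum-over-S₊ m counts k p>0 q>0 q-last Σp≡Σq
  , m⊤≡alternating-sum-over-S₋ m counts k p>0 q>0 q-last Σp≡Σq
  where open Faces r' s' p q
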